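{- Let $G$ be a connected block graph, let $\mathrm{CP}(B_1,\dots,B_n)$ ($n\ge1$) be an induced $n$-clique path in $G$ with $n$ maximum, with connecting vertices $x_1,\dots,x_{n-1}$, let $r\ge1$, and let $\mathcal{H}$ be a $c'$-minor of $\mathcal{C}_r(G)$ with $|E(\mathcal{H})|\ge 3$. Let $V_1, V_2,\dots$ be the simplicial layers of $G$ and $\ell = \min\{i : V_i\cap V(\mathcal{H})\neq\emptyset\}$. Suppose $\ell\neq 1$ and $r<n$. Let $x_0 \in V(B_1)\cap V_1$. If $x_0,x_1,\dots,x_{r-2}\notin V(\mathcal{H})$, then $x_{r-1}\in V(\mathcal{H})$; moreover, every $y \in N_G(x_{r-1})\setminus\{x_{r-2}\}$ lies in $V(\mathcal{H})$.
   Context: A block of a graph is a maximal connected subgraph that remains connected after removing any single vertex; a block graph is one whose blocks are all complete. An $n$-clique path $\mathrm{CP}(B_1,\dots,B_n)$ consists of cliques $B_1,\dots,B_n$ arranged linearly, consecutive cliques $B_i,B_{i+1}$ sharing exactly one vertex $x_i$ (the connecting vertices). A vertex of a graph is simplicial if its neighbors are pairwise adjacent. Simplicial layers: $V_1$ is the set of simplicial vertices of $G$, and for $i\ge2$, $V_i$ is the set of simplicial vertices of the induced subgraph $G\setminus(V_1\cup\dots\cup V_{i-1})$. $N_G(x)$ denotes the set of neighbors of $x$. A hypergraph consists of a vertex set and subsets (edges), none contained in another. $\mathcal{C}_r(G)$ is the hypergraph on $V(G)$ whose edges are all $S\subseteq V(G)$ with $|S|=r+1$ and $G[S]$ connected.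 Contraction $\mathcal{H}/v$: vertex set $V(\mathcal{H})\setminus\{v\}$, edges the inclusion-minimal members of $\{e\setminus\{v\}: e\in E(\mathcal{H})\}$. A $c$-minor is a hypergraph obtained by contracting a set of vertices (no deletions); a $c'$-minor is a $c$-minor with no singleton edges. -}

module Defs where

open import Data.Nat using (ℕ; zero; suc; _+_; _≤_; _<_; _∸_)
open import Data.Fin using (Fin)
open import Data.Fin.Subset using (Subset; _∈_; _∉_; _⊆_; _∩_; _-_; _─_; ∣_∣; ⁅_⁆; ⊤)
open import Data.List using (List; []; _∷_)
open import Data.Product using (Σ; ∃; _×_; _,_)
open import Data.Empty renaming (⊥ to Empty)
open import Data.Unit using () renaming (⊤ to Unit)
open import Relation.Nullary using (¬_)
open import Relation.Binary.PropositionalEquality using (_≡_; _≢_)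

record Graph (N : ℕ) : Set₁ where
  field
    Adj   : Fin N → Fin N → Set
    sym   : ∀ {u v} → Adj u v → Adj v u
    irrefl : ∀ {u} → ¬ Adj u u
open Graph public

module _ {N : ℕ} (G : Graph N) where

  data Reach (S : Subset N) : Fin N → Fin N → Set where
    here : ∀ {u} → u ∈ S → Reach S u u
    step : ∀ {u w v} → u ∈ S → Adj G u w → Reach S w v → Reach S u v

  Connected : Subset N → Set
  Connected S = ∀ u v → u ∈ S → v ∈ S → Reach S u v

  Complete : Subset N → Set
  Complete S = ∀ u v → u ∈ S → v ∈ S → u ≢ v → Adj G u v

  Nonseparable : Subset N → Set
  Nonseparable S = Connected S × (∀ v → v ∈ S → Connected (S - v))

  IsBlock : Subset N → Set
  IsBlock S = Nonseparable S × (∀ T → S ⊆ T → Nonseparable T → T ≡ S)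

  IsBlockGraph : Set
  IsBlockGraph = ∀ S → IsBlock S → Complete S

  IsConnectedGraph : Set
  IsConnectedGraph = Connected ⊤

  N[_] : Fin N → Fin N → Set
  N[ x ] y = Adj G x y

  SimplicialIn : (Fin N → Set) → Fin N → Set
  SimplicialIn R v = R v × (∀ a b → R a → R b → Adj G v a → Adj G v b → a ≢ b → Adj G a b)

  -- Remaining i = V(G) ∖ (V_1 ∪ … ∪ V_i)
  Remaining : ℕ → Fin N → Set
  Remaining zero    v = Unit
  Remaining (suc i) v = Remaining i v × ¬ SimplicialIn (Remaining i) v

  -- Layer i v  ⇔  v ∈ V_i   (layers are indexed from 1; Layer 0 is empty)
  Layer : ℕ → Fin N → Set
  Layer zero    v = Empty
  Layer (suc i) v = SimplicialIn (Remaining i) v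

  -- Induced n-clique paths CP(B_1,…,B_n), cliques indexed 1..n,
  -- connecting vertices x_1,…,x_{n-1} (x i for 1 ≤ i ≤ n-1)

  IsClique : Subset N → Set
  IsClique S = Complete S × 2 ≤ ∣ S ∣

  InUnion : ℕ → (ℕ → Subset N) → Fin N → Set
  InUnion n B v = ∃ λ i → 1 ≤ i × i ≤ n × v ∈ B i

  IsInducedCliquePath : ℕ → (ℕ → Subset N) → (ℕ → Fin N) → Set
  IsInducedCliquePath n B x =
      1 ≤ n
    × (∀ i → 1 ≤ i → i ≤ n → IsClique (B i))
    × (∀ i → 1 ≤ i → i < n → B i ∩ B (suc i) ≡ ⁅ x i ⁆)
    × (∀ i j → 1 ≤ i → i + 2 ≤ j → j ≤ n → ∀ v → v ∈ B i → v ∈ B j → Empty)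
    × (∀ u v → InUnion n B u → InUnion n B v → Adj G u v →
         ∃ λ i → 1 ≤ i × i ≤ n × u ∈ B i × v ∈ B i)

  MaximumCliquePath : ℕ → (ℕ → Subset N) → (ℕ → Fin N) → Set
  MaximumCliquePath n B x =
    IsInducedCliquePath n B x ×
    (∀ m B′ x′ → IsInducedCliquePath m B′ x′ → m ≤ n)

record Hyp (N : ℕ) : Set₁ where
  field
    V : Subset N
    E : Subset N → Set
open Hyp public

_≈H_ : ∀ {N} → Hyp N → Hyp N → Set
H ≈H K = (V H ≡ V K) × (∀ f → (E H f → E K f) × (E K f → E H f))

𝒞 : ∀ {N} → ℕ → Graph N → Hyp N
𝒞 r G = record { V = ⊤ ; E = λ S → (∣ S ∣ ≡ suc r) × Connected G S }

contract : ∀ {N} → Hyp N → Fin N → Hyp N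
contract H v = record
  { V = V H - v
  ; E = λ f → (∃ λ e → E H e × f ≡ e - v)
              × (∀ e → E H e → (e - v) ⊆ f → (e - v) ≡ f)
  }

contractAll : ∀ {N} → Hyp N → List (Fin N) → Hyp N
contractAll H []       = H
contractAll H (v ∷ vs) = contractAll (contract H v) vs

IsCMinor : ∀ {N} → Hyp N → Hyp N → Set
IsCMinor H K = ∃ λ vs → H ≈H contractAll K vs

IsC′Minor : ∀ {N} → Hyp N → Hyp N → Set
IsC′Minor H K = IsCMinor H K × (∀ f → E H f → ∣ f ∣ ≢ 1)

AtLeast3Edges : ∀ {N} → Hyp N → Set
AtLeast3Edges H = ∃ λ e₁ → ∃ λ e₂ → ∃ λ e₃ →
  E H e₁ × E H e₂ × E H e₃ × e₁ ≢ e₂ × e₁ ≢ e₃ × e₂ ≢ e₃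

IsLeastLayer : ∀ {N} → Graph N → Hyp N → ℕ → Set
IsLeastLayer G H ℓ =
  (∃ λ v → Layer G ℓ v × v ∈ V H) ×
  (∀ i v → Layer G i v → v ∈ V H → ℓ ≤ i)

withX0 : ∀ {N} → Fin N → (ℕ → Fin N) → ℕ → Fin N
withX0 x₀ x zero    = x₀
withX0 x₀ x (suc i) = x (suc i)

-- Along the clique path, x₀, x₁, …, x_{r−1} form an induced path (x₀ ≠ x₁ since x₀ is simplicial and
-- x₁ is not), and a neighbour y of x_{r−1} other than x_{r−2} lies off it. So {x₀, …, x_{r−1}, y} is a
-- connected set of r + 1 vertices, i.e. an edge of 𝒞_r(G). Contraction only shrinks edges: choosing
-- inclusion-minimal contracted edges, every edge of 𝒞_r(G) contains an edge f of H. This f is non-empty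
-- (an empty edge would be the only edge), not a singleton, and avoids x₀, …, x_{r−2} ∉ V(H); hence
-- f = {x_{r−1}, y} ⊆ V(H). For the first claim take y ∈ B_r ∖ {x_{r−1}}.

module Submission where

open import Defs hiding (sym)
open import Data.Nat using (ℕ; zero; suc; _+_; _≤_; _<_; _∸_; z≤n; s≤s; _≤?_)
open import Data.Nat.Properties
  using (≤-refl; ≤-reflexive; ≤-trans; ≤-antisym; <-trans; <⇒≤; ≤-pred; ≰⇒>; n≤1+n; m≤n⇒m<n∨m≡n; +-comm)
open import Data.Nat.Induction using (<-wellFounded)
open import Data.Fin using (Fin; zero; suc) renaming (_≟_ to _≟ᶠ_)
open import Data.Fin.Properties using (any?)
open import Data.Fin.Subset using (Subset; _∈_; _∉_; _⊆_; _⊂_; _-_; _─_; ∣_∣; ⁅_⁆; ⊥; _∪_; inside; outside)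
open import Data.Fin.Subset.Properties
  using (_∈?_; _⊂?_; ⊥⊆; ⊆-refl; ⊆-trans; ⊆-antisym; p⊂q⇒p⊆q; p⊂q⇒∣p∣<∣q∣; p⊆q⇒∣p∣≤∣q∣; p─q⊆p; x∈p∧x≢y⇒x∈p-y;
         x∈⁅x⁆; x∈⁅y⁆⇒x≡y; ∣⁅x⁆∣≡1; ∣⊥∣≡0; Empty-unique; ∪-identityˡ; x∈p∪q⁻; x∈p∪q⁺; q⊆p∪q; x∈p∩q⁻; x∈p∩q⁺; ∈⊤)
open import Data.List using ([]; _∷_)
open import Data.Vec.Base using (_∷_; _[_]=_)
open _[_]=_
open import Data.Product using (∃; ∃₂; _×_; _,_; proj₁; proj₂)
open import Data.Sum using (_⊎_; inj₁; inj₂; swap)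
open import Data.Empty using (⊥-elim) renaming (⊥ to Empty)
open import Function using (_∘_; _on_)
open import Induction.WellFounded using (Acc; acc)
open import Relation.Binary.Construct.On using (wellFounded)
open import Relation.Nullary using (¬_; yes; no; ¬?)
open import Relation.Nullary.Decidable using (_×-dec_; decidable-stable; ¬¬-excluded-middle)
open import Relation.Nullary.Negation using (DoubleNegation; contradiction)
open import Relation.Binary.PropositionalEquality using (_≡_; _≢_; refl; sym; trans; subst; cong)

x∈p─q⇒x∉q : ∀ {n} (p q : Subset n) {x} → x ∈ p ─ q → x ∉ q
x∈p─q⇒x∉q (_ ∷ p) (outside ∷ q) here ()
x∈p─q⇒x∉q (_ ∷ p) (_ ∷ q) (there x∈p─q) (there x∈q) = x∈p─q⇒x∉q p q x∈p─q x∈q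

x∈p-y⇒x≢y : ∀ {n} (p : Subset n) {x y} → x ∈ p - y → x ≢ y
x∈p-y⇒x≢y p {y = y} x∈p-y refl = x∈p─q⇒x∉q p ⁅ y ⁆ x∈p-y (x∈⁅x⁆ y)

∣⁅x⁆∪p∣≡1+∣p∣ : ∀ {n} (x : Fin n) (p : Subset n) → x ∉ p → ∣ ⁅ x ⁆ ∪ p ∣ ≡ suc ∣ p ∣
∣⁅x⁆∪p∣≡1+∣p∣ zero    (outside ∷ p) _   = cong (suc ∘ ∣_∣) (∪-identityˡ p)
∣⁅x⁆∪p∣≡1+∣p∣ zero    (inside ∷ p)  x∉p = contradiction here x∉p
∣⁅x⁆∪p∣≡1+∣p∣ (suc x) (inside ∷ p)  x∉p = cong suc (∣⁅x⁆∪p∣≡1+∣p∣ x p (x∉p ∘ there))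
∣⁅x⁆∪p∣≡1+∣p∣ (suc x) (outside ∷ p) x∉p = ∣⁅x⁆∪p∣≡1+∣p∣ x p (x∉p ∘ there)

⊆⇒≡⊎⊂ : ∀ {n} {p q : Subset n} → p ⊆ q → p ≡ q ⊎ p ⊂ q
⊆⇒≡⊎⊂ {p = p} {q} p⊆q with p ⊂? q
... | yes p⊂q = inj₂ p⊂q
... | no  p⊄q = inj₁ (⊆-antisym p⊆q q⊆p)
  where
  q⊆p : q ⊆ p
  q⊆p {x} x∈q = decidable-stable (x ∈? p) (λ x∉p → p⊄q (p⊆q , x , x∈q , x∉p))

⊆⁅x⁆⇒≡⊥⊎≡⁅x⁆ : ∀ {n} {p : Subset n} x → p ⊆ ⁅ x ⁆ → p ≡ ⊥ ⊎ p ≡ ⁅ x ⁆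
⊆⁅x⁆⇒≡⊥⊎≡⁅x⁆ {p = p} x p⊆⁅x⁆ with x ∈? p
... | yes x∈p = inj₂ (⊆-antisym p⊆⁅x⁆ (λ u∈⁅x⁆ → subst (_∈ p) (sym (x∈⁅y⁆⇒x≡y x u∈⁅x⁆)) x∈p))
... | no  x∉p = inj₁ (Empty-unique λ (u , u∈p) → x∉p (subst (_∈ p) (x∈⁅y⁆⇒x≡y x (p⊆⁅x⁆ u∈p)) u∈p))

nonsingleton⊆pair⇒∈ : ∀ {n} {p : Subset n} {a b} →
  (∀ {u} → u ∈ p → u ≡ a ⊎ u ≡ b) → p ≢ ⊥ → ∣ p ∣ ≢ 1 → a ∈ p
nonsingleton⊆pair⇒∈ {p = p} {a} {b} ⊆pair p≢⊥ ∣p∣≢1 with a ∈? p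
... | yes a∈p = a∈p
... | no  a∉p with ⊆⁅x⁆⇒≡⊥⊎≡⁅x⁆ b p⊆⁅b⁆
  where
  p⊆⁅b⁆ : p ⊆ ⁅ b ⁆
  p⊆⁅b⁆ u∈p with ⊆pair u∈p
  ... | inj₁ refl = contradiction u∈p a∉p
  ... | inj₂ refl = x∈⁅x⁆ _
...   | inj₁ p≡⊥   = contradiction p≡⊥ p≢⊥
...   | inj₂ p≡⁅b⁆ = contradiction (trans (cong ∣_∣ p≡⁅b⁆) (∣⁅x⁆∣≡1 b)) ∣p∣≢1

∃∈-≢ : ∀ {n} {p : Subset n} → 2 ≤ ∣ p ∣ → ∀ x → ∃ λ y → y ∈ p × y ≢ x
∃∈-≢ {p = p} 2≤∣p∣ x with any? (λ y → y ∈? p ×-dec ¬? (y ≟ᶠ x))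
... | yes found = found
... | no  none  =
  contradiction (≤-trans 2≤∣p∣ (≤-trans (p⊆q⇒∣p∣≤∣q∣ p⊆⁅x⁆) (≤-reflexive (∣⁅x⁆∣≡1 x)))) λ { (s≤s ()) }
  where
  p⊆⁅x⁆ : p ⊆ ⁅ x ⁆
  p⊆⁅x⁆ {y} y∈p = subst (_∈ ⁅ x ⁆) (sym (decidable-stable (y ≟ᶠ x) λ y≢x → none (y , y∈p , y≢x))) (x∈⁅x⁆ x)

IsMinimal : ∀ {n} → (Subset n → Set) → Subset n → Set
IsMinimal P f = P f × (∀ h → P h → h ⊆ f → h ≡ f)

-- The predicate P is arbitrary, so a minimal element below g exists only classically; the final
-- goal is a decidable membership, hence stable under double negation.
minimal-⊆ : ∀ {n} (P : Subset n → Set) {g} → P g → DoubleNegation (∃ λ f → IsMinimal P f × f ⊆ g)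
minimal-⊆ P {g} = go g (wellFounded ∣_∣ <-wellFounded g)
  where
  minimal-if-none-below : ∀ {g} → ¬ (∃ λ h → P h × h ⊂ g) → ∀ h → P h → h ⊆ g → h ≡ g
  minimal-if-none-below ∄h⊂g h Ph h⊆g with ⊆⇒≡⊎⊂ h⊆g
  ... | inj₁ h≡g = h≡g
  ... | inj₂ h⊂g = contradiction (h , Ph , h⊂g) ∄h⊂g

  go : ∀ g → Acc (_<_ on ∣_∣) g → P g → DoubleNegation (∃ λ f → IsMinimal P f × f ⊆ g)
  go g (acc rec) Pg ∄f = ¬¬-excluded-middle {A = ∃ λ h → P h × h ⊂ g} λ where
    (yes (h , Ph , h⊂g)) → go h (rec (p⊂q⇒∣p∣<∣q∣ h⊂g)) Ph λ (f , f-min , f⊆h) →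
      ∄f (f , f-min , ⊆-trans f⊆h (p⊂q⇒p⊆q h⊂g))
    (no ∄h⊂g) → ∄f (g , (Pg , minimal-if-none-below ∄h⊂g) , ⊆-refl)

Refines : ∀ {N} → Hyp N → Hyp N → Set
Refines K K′ = ∀ e → E K e → DoubleNegation (∃ λ f → E K′ f × f ⊆ e)

refines-trans : ∀ {N} {K K′ K″ : Hyp N} → Refines K K′ → Refines K′ K″ → Refines K K″
refines-trans K⊑K′ K′⊑K″ e Ee ∄g =
  K⊑K′ e Ee λ (f , E′f , f⊆e) → K′⊑K″ f E′f λ (g , E″g , g⊆f) → ∄g (g , E″g , ⊆-trans g⊆f f⊆e)

contract-refines : ∀ {N} (K : Hyp N) v → Refines K (contract K v)
contract-refines K v e Ee ∄f = minimal-⊆ Restriction (e , Ee , refl) λ (f , (Pf , f-min) , f⊆e-v) →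
  ∄f (f , (Pf , λ e′ Ee′ → f-min (e′ - v) (e′ , Ee′ , refl)) , ⊆-trans f⊆e-v (p─q⊆p e ⁅ v ⁆))
  where
  Restriction : Subset _ → Set
  Restriction h = ∃ λ e → E K e × h ≡ e - v

contractAll-refines : ∀ {N} (K : Hyp N) vs → Refines K (contractAll K vs)
contractAll-refines K []       e Ee ∄f = ∄f (e , Ee , ⊆-refl)
contractAll-refines K (v ∷ vs) =
  refines-trans {K = K} {K′ = contract K v} {K″ = contractAll (contract K v) vs}
    (contract-refines K v) (contractAll-refines (contract K v) vs)

contractAll-preserves : ∀ {N} (P : Hyp N → Set) → (∀ K v → P K → P (contract K v)) →
  ∀ K vs → P K → P (contractAll K vs)
contractAll-preserves P P-contract K []       PK = PK
contractAll-preserves P P-contract K (v ∷ vs) PK =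
  contractAll-preserves P P-contract (contract K v) vs (P-contract K v PK)

EmptyEdgeIsolated : ∀ {N} → Hyp N → Set
EmptyEdgeIsolated K = E K ⊥ → ∀ f → E K f → f ≡ ⊥

EdgesWithinVertices : ∀ {N} → Hyp N → Set
EdgesWithinVertices K = ∀ e → E K e → e ⊆ V K

-- An empty contracted edge lies below every other contracted edge, so minimality forces equality.
contract-emptyEdgeIsolated : ∀ {N} (K : Hyp N) v → EmptyEdgeIsolated (contract K v)
contract-emptyEdgeIsolated K v ((e₀ , Ee₀ , ⊥≡e₀-v) , _) f ((_ , _ , _) , f-min) =
  trans (sym (f-min e₀ Ee₀ (subst (_⊆ f) ⊥≡e₀-v ⊥⊆))) (sym ⊥≡e₀-v)

contract-edgesWithinVertices : ∀ {N} (K : Hyp N) v → EdgesWithinVertices K → EdgesWithinVertices (contract K v)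
contract-edgesWithinVertices K v within f ((e , Ee , refl) , _) u∈e-v =
  x∈p∧x≢y⇒x∈p-y (within e Ee (p─q⊆p e ⁅ v ⁆ u∈e-v)) (x∈p-y⇒x≢y e u∈e-v)

𝒞-emptyEdgeIsolated : ∀ {N} r (G : Graph N) → EmptyEdgeIsolated (𝒞 r G)
𝒞-emptyEdgeIsolated {N} r G (∣⊥∣≡1+r , _) with () ← trans (sym (∣⊥∣≡0 N)) ∣⊥∣≡1+r

𝒞-edgesWithinVertices : ∀ {N} r (G : Graph N) → EdgesWithinVertices (𝒞 r G)
𝒞-edgesWithinVertices r G e _ _ = ∈⊤

HasTwoEdges : ∀ {N} → Hyp N → Set
HasTwoEdges H = ∃₂ λ e₁ e₂ → E H e₁ × E H e₂ × e₁ ≢ e₂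

c′-minor-edge-inside : ∀ {N} {H K : Hyp N} → IsC′Minor H K → EmptyEdgeIsolated K → EdgesWithinVertices K →
  HasTwoEdges H → ∀ e → E K e →
  DoubleNegation (∃ λ f → E H f × f ⊆ e × f ⊆ V H × f ≢ ⊥ × ∣ f ∣ ≢ 1)
c′-minor-edge-inside {H = H} {K = K} ((vs , VH≡ , E⇔) , no-singleton) isolated within
  (e₁ , e₂ , E₁ , E₂ , e₁≢e₂) e Ee ∄f =
  contractAll-refines K vs e Ee λ (f , E′f , f⊆e) →
    ∄f (f , proj₂ (E⇔ f) E′f , f⊆e , f⊆VH f E′f , f≢⊥ f E′f , no-singleton f (proj₂ (E⇔ f) E′f))
  where
  K′ = contractAll K vs
  f⊆VH : ∀ f → E K′ f → f ⊆ V H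
  f⊆VH f E′f = subst (_ ∈_) (sym VH≡)
    ∘ contractAll-preserves EdgesWithinVertices (contract-edgesWithinVertices) K vs within f E′f
  f≢⊥ : ∀ f → E K′ f → f ≢ ⊥
  f≢⊥ f E′f refl = e₁≢e₂ (trans (isolated′ e₁ (proj₁ (E⇔ e₁) E₁)) (sym (isolated′ e₂ (proj₁ (E⇔ e₂) E₂))))
    where
    isolated′ : ∀ g → E K′ g → g ≡ ⊥
    isolated′ = contractAll-preserves EmptyEdgeIsolated (λ K v _ → contract-emptyEdgeIsolated K v) K vs isolated E′f

module _ {N : ℕ} (G : Graph N) where

  Reach-start∈ : ∀ {S u v} → Reach G S u v → u ∈ S
  Reach-start∈ (here u∈S)     = u∈S
  Reach-start∈ (step u∈S _ _) = u∈S

  Reach-++ : ∀ {S u w v} → Reach G S u w → Reach G S w v → Reach G S u v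
  Reach-++ (here _)            q = q
  Reach-++ (step u∈S u~u′ p) q = step u∈S u~u′ (Reach-++ p q)

  Reach-reverse : ∀ {S u v} → Reach G S u v → Reach G S v u
  Reach-reverse (here u∈S)        = here u∈S
  Reach-reverse (step u∈S u~u′ p) = Reach-++ (Reach-reverse p) (step (Reach-start∈ p) (Graph.sym G u~u′) (here u∈S))

  Reach-mono : ∀ {S S′ u v} → S ⊆ S′ → Reach G S u v → Reach G S′ u v
  Reach-mono S⊆S′ (here u∈S)        = here (S⊆S′ u∈S)
  Reach-mono S⊆S′ (step u∈S u~u′ p) = step (S⊆S′ u∈S) u~u′ (Reach-mono S⊆S′ p)

  hub⇒connected : ∀ {S a} → (∀ u → u ∈ S → Reach G S u a) → Connected G S
  hub⇒connected to-a u v u∈S v∈S = Reach-++ (to-a u u∈S) (Reach-reverse (to-a v v∈S))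

  ⁅⁆-connected : ∀ a → Connected G ⁅ a ⁆
  ⁅⁆-connected a = hub⇒connected λ u u∈⁅a⁆ → subst (λ u → Reach G ⁅ a ⁆ u a) (sym (x∈⁅y⁆⇒x≡y a u∈⁅a⁆)) (here (x∈⁅x⁆ a))

  ∪⁅⁆-connected : ∀ {S a y} → Connected G S → a ∈ S → Adj G a y → Connected G (⁅ y ⁆ ∪ S)
  ∪⁅⁆-connected {S} {a} {y} S-connected a∈S a~y = hub⇒connected to-a
    where
    S⊆S′ : S ⊆ ⁅ y ⁆ ∪ S
    S⊆S′ = q⊆p∪q ⁅ y ⁆ S
    to-a : ∀ u → u ∈ ⁅ y ⁆ ∪ S → Reach G (⁅ y ⁆ ∪ S) u a
    to-a u u∈S′ with x∈p∪q⁻ ⁅ y ⁆ S u∈S′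
    ... | inj₂ u∈S   = Reach-mono S⊆S′ (S-connected u a u∈S a∈S)
    ... | inj₁ u∈⁅y⁆ rewrite x∈⁅y⁆⇒x≡y y u∈⁅y⁆ = step u∈S′ (Graph.sym G a~y) (here (S⊆S′ a∈S))

module _ {N : ℕ} (w : ℕ → Fin N) where

  imageUpTo : ℕ → Subset N
  imageUpTo zero    = ⁅ w zero ⁆
  imageUpTo (suc k) = ⁅ w (suc k) ⁆ ∪ imageUpTo k

  ∈imageUpTo⁻ : ∀ {k u} → u ∈ imageUpTo k → ∃ λ i → i ≤ k × u ≡ w i
  ∈imageUpTo⁻ {zero}  u∈ = 0 , z≤n , x∈⁅y⁆⇒x≡y (w 0) u∈
  ∈imageUpTo⁻ {suc k} u∈ with x∈p∪q⁻ ⁅ w (suc k) ⁆ (imageUpTo k) u∈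
  ... | inj₁ u∈⁅wk⁆ = suc k , ≤-refl , x∈⁅y⁆⇒x≡y (w (suc k)) u∈⁅wk⁆
  ... | inj₂ u∈     with ∈imageUpTo⁻ u∈
  ...   | i , i≤k , u≡wi = i , ≤-trans i≤k (n≤1+n k) , u≡wi

  ∈imageUpTo⁺ : ∀ {k i} → i ≤ k → w i ∈ imageUpTo k
  ∈imageUpTo⁺ {zero}  z≤n = x∈⁅x⁆ (w 0)
  ∈imageUpTo⁺ {suc k} i≤1+k with m≤n⇒m<n∨m≡n i≤1+k
  ... | inj₁ (s≤s i≤k) = x∈p∪q⁺ (inj₂ (∈imageUpTo⁺ i≤k))
  ... | inj₂ refl      = x∈p∪q⁺ (inj₁ (x∈⁅x⁆ (w (suc k))))

  ∣imageUpTo∣ : ∀ {k} → (∀ {i j} → i < j → j ≤ k → w i ≢ w j) → ∣ imageUpTo k ∣ ≡ suc k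
  ∣imageUpTo∣ {zero}  _         = ∣⁅x⁆∣≡1 (w 0)
  ∣imageUpTo∣ {suc k} injective =
    trans (∣⁅x⁆∪p∣≡1+∣p∣ (w (suc k)) (imageUpTo k) wk∉)
          (cong suc (∣imageUpTo∣ λ i<j j≤k → injective i<j (≤-trans j≤k (n≤1+n k))))
    where
    wk∉ : w (suc k) ∉ imageUpTo k
    wk∉ wk∈ with ∈imageUpTo⁻ wk∈
    ... | i , i≤k , wk≡wi = injective (s≤s i≤k) ≤-refl (sym wk≡wi)

  imageUpTo-connected : ∀ (G : Graph N) {k} → (∀ {i} → i < k → Adj G (w i) (w (suc i))) → Connected G (imageUpTo k)
  imageUpTo-connected G {zero}  _        = ⁅⁆-connected G (w 0)
  imageUpTo-connected G {suc k} adjacent =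
    ∪⁅⁆-connected G (imageUpTo-connected G λ i<k → adjacent (≤-trans i<k (n≤1+n k)))
      (∈imageUpTo⁺ (≤-refl {k})) (adjacent ≤-refl)

pendant-path-ends∈V : ∀ {N} (G : Graph N) (H : Hyp N) {k} (w : ℕ → Fin N) {y} →
  IsC′Minor H (𝒞 (suc k) G) → HasTwoEdges H →
  (∀ {i j} → i < j → j ≤ k → w i ≢ w j) → (∀ {i} → i < k → Adj G (w i) (w (suc i))) →
  (∀ {i} → i < k → w i ∉ V H) → Adj G (w k) y → (∀ {i} → i ≤ k → y ≢ w i) →
  w k ∈ V H × y ∈ V H
pendant-path-ends∈V G H {k} w {y} minor two-edges injective adjacent w∉VH wk~y y-off =
  decidable-stable (w k ∈? V H ×-dec y ∈? V H) λ ends∉VH →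
    c′-minor-edge-inside minor (𝒞-emptyEdgeIsolated (suc k) G) (𝒞-edgesWithinVertices (suc k) G) two-edges T T-edge
      λ (f , _ , f⊆T , f⊆VH , f≢⊥ , ∣f∣≢1) → ends∉VH
        ( f⊆VH (nonsingleton⊆pair⇒∈ (λ u∈f → T∩VH⊆ends (f⊆T u∈f) (f⊆VH u∈f)) f≢⊥ ∣f∣≢1)
        , f⊆VH (nonsingleton⊆pair⇒∈ (λ u∈f → swap (T∩VH⊆ends (f⊆T u∈f) (f⊆VH u∈f))) f≢⊥ ∣f∣≢1) )
  where
  T : Subset _
  T = ⁅ y ⁆ ∪ imageUpTo w k

  y∉path : y ∉ imageUpTo w k
  y∉path y∈ with ∈imageUpTo⁻ w y∈
  ... | i , i≤k , y≡wi = y-off i≤k y≡wi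

  T-edge : E (𝒞 (suc k) G) T
  T-edge = trans (∣⁅x⁆∪p∣≡1+∣p∣ y _ y∉path) (cong suc (∣imageUpTo∣ w injective))
         , ∪⁅⁆-connected G (imageUpTo-connected w G adjacent) (∈imageUpTo⁺ w ≤-refl) wk~y

  T∩VH⊆ends : ∀ {u} → u ∈ T → u ∈ V H → u ≡ w k ⊎ u ≡ y
  T∩VH⊆ends {u} u∈T u∈VH with x∈p∪q⁻ ⁅ y ⁆ (imageUpTo w k) u∈T
  ... | inj₁ u∈⁅y⁆ = inj₂ (x∈⁅y⁆⇒x≡y y u∈⁅y⁆)
  ... | inj₂ u∈path with ∈imageUpTo⁻ w u∈path
  ...   | i , i≤k , refl with m≤n⇒m<n∨m≡n i≤k
  ...     | inj₁ i<k  = contradiction u∈VH (w∉VH i<k)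
  ...     | inj₂ refl = inj₁ refl

module InducedCliquePath {N : ℕ} (G : Graph N) {n : ℕ} {B : ℕ → Subset N} {x : ℕ → Fin N}
  (cp : IsInducedCliquePath G n B x) {x₀ : Fin N} (x₀∈B₁ : x₀ ∈ B 1) (x₀-simplicial : Layer G 1 x₀) where

  private
    clique   = proj₁ (proj₂ cp)
    meet     = proj₁ (proj₂ (proj₂ cp))
    disjoint = proj₁ (proj₂ (proj₂ (proj₂ cp)))
    induced  = proj₂ (proj₂ (proj₂ (proj₂ cp)))

  w : ℕ → Fin N
  w = withX0 x₀ x

  cliques-apart : ∀ {i j v} → 1 ≤ i → 2 + i ≤ j → j ≤ n → v ∈ B i → v ∈ B j → Empty
  cliques-apart {i} {j} 1≤i 2+i≤j j≤n = disjoint i j 1≤i (subst (_≤ j) (+-comm 2 i) 2+i≤j) j≤n _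

  shared-index-near : ∀ {i j v} → 1 ≤ i → j ≤ n → v ∈ B i → v ∈ B j → j ≤ suc i
  shared-index-near {i} {j} 1≤i j≤n v∈Bi v∈Bj with j ≤? suc i
  ... | yes j≤1+i = j≤1+i
  ... | no  j≰1+i = ⊥-elim (cliques-apart 1≤i (≰⇒> j≰1+i) j≤n v∈Bi v∈Bj)

  shared-consecutive≡x : ∀ {i v} → 1 ≤ i → i < n → v ∈ B i → v ∈ B (suc i) → v ≡ x i
  shared-consecutive≡x {i} 1≤i i<n v∈Bi v∈B1+i =
    x∈⁅y⁆⇒x≡y (x i) (subst (_ ∈_) (meet i 1≤i i<n) (x∈p∩q⁺ (v∈Bi , v∈B1+i)))

  x∈B : ∀ {i} → 1 ≤ i → i < n → x i ∈ B i × x i ∈ B (suc i)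
  x∈B {i} 1≤i i<n = x∈p∩q⁻ (B i) (B (suc i)) (subst (x i ∈_) (sym (meet i 1≤i i<n)) (x∈⁅x⁆ (x i)))

  w∈B : ∀ {i} → i < n → w i ∈ B (suc i)
  w∈B {zero}  _   = x₀∈B₁
  w∈B {suc i} i<n = proj₂ (x∈B (s≤s z≤n) i<n)

  w∈B-pred : ∀ {i} → suc i < n → w (suc i) ∈ B (suc i)
  w∈B-pred i<n = proj₁ (x∈B (s≤s z≤n) i<n)

  clique-adjacent : ∀ {i u v} → 1 ≤ i → i ≤ n → u ∈ B i → v ∈ B i → u ≢ v → Adj G u v
  clique-adjacent {i} 1≤i i≤n = proj₁ (clique i 1≤i i≤n) _ _

  x₁-neighbours-nonadjacent : 1 < n → ∀ {u v} → u ∈ B 1 → v ∈ B 2 → u ≢ x 1 → v ≢ x 1 → ¬ Adj G u v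
  x₁-neighbours-nonadjacent 1<n {u} {v} u∈B₁ v∈B₂ u≢x₁ v≢x₁ u~v
    with induced u v (1 , ≤-refl , <⇒≤ 1<n , u∈B₁) (2 , s≤s z≤n , 1<n , v∈B₂) u~v
  ... | 1 , _ , _ , _ , v∈B₁ = v≢x₁ (shared-consecutive≡x ≤-refl 1<n v∈B₁ v∈B₂)
  ... | 2 , _ , _ , u∈B₂ , _ = u≢x₁ (shared-consecutive≡x ≤-refl 1<n u∈B₁ u∈B₂)
  ... | suc (suc (suc m)) , _ , 3+m≤n , u∈B₃₊ₘ , _ = cliques-apart ≤-refl (s≤s (s≤s (s≤s z≤n))) 3+m≤n u∈B₁ u∈B₃₊ₘ

  x₀≢x₁ : 1 < n → x₀ ≢ x 1
  x₀≢x₁ 1<n x₀≡x₁ with ∃∈-≢ (proj₂ (clique 1 ≤-refl (<⇒≤ 1<n))) (x 1) | ∃∈-≢ (proj₂ (clique 2 (s≤s z≤n) 1<n)) (x 1)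
  ... | u , u∈B₁ , u≢x₁ | v , v∈B₂ , v≢x₁ =
    x₁-neighbours-nonadjacent 1<n u∈B₁ v∈B₂ u≢x₁ v≢x₁
      (proj₂ (subst (Layer G 1) x₀≡x₁ x₀-simplicial) u v _ _
        (clique-adjacent ≤-refl (<⇒≤ 1<n) x₁∈B₁ u∈B₁ (u≢x₁ ∘ sym))
        (clique-adjacent (s≤s z≤n) 1<n x₁∈B₂ v∈B₂ (v≢x₁ ∘ sym))
        λ { refl → u≢x₁ (shared-consecutive≡x ≤-refl 1<n u∈B₁ v∈B₂) })
    where
    x₁∈B₁ = proj₁ (x∈B ≤-refl 1<n)
    x₁∈B₂ = proj₂ (x∈B ≤-refl 1<n)

  w-injective : ∀ {i j} → i < j → j < n → w i ≢ w j
  w-injective {zero}  {suc zero}    _     1<n = x₀≢x₁ 1<n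
  w-injective {zero}  {suc (suc j)} _     j<n w₀≡wj =
    cliques-apart ≤-refl (s≤s (s≤s (s≤s z≤n))) j<n x₀∈B₁ (subst (_∈ B _) (sym w₀≡wj) (w∈B j<n))
  w-injective {suc i} {j}           i<j   j<n wi≡wj =
    cliques-apart (s≤s z≤n) (s≤s i<j) j<n (w∈B-pred (<-trans i<j j<n)) (subst (_∈ B (suc j)) (sym wi≡wj) (w∈B j<n))

  w-adjacent : ∀ {i} → suc i < n → Adj G (w i) (w (suc i))
  w-adjacent {i} 1+i<n =
    clique-adjacent (s≤s z≤n) (<⇒≤ 1+i<n) (w∈B (<⇒≤ 1+i<n)) (w∈B-pred 1+i<n) (w-injective ≤-refl 1+i<n)

  -- A clique containing w_k and w_i would have to be B_{i+2} = B_k, putting w_i in B_{i+1} ∩ B_{i+2} = {w_{i+1}}.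
  no-clique-spans-gap : ∀ {k i m} → k < n → suc i < k → 1 ≤ m → m ≤ n → w k ∈ B m → w i ∈ B m → Empty
  no-clique-spans-gap {k} {i} {m} k<n 1+i<k 1≤m m≤n wk∈Bm wi∈Bm =
    w-injective ≤-refl 1+i<n (shared-consecutive≡x (s≤s z≤n) 1+i<n (w∈B i<n) (subst (λ j → w i ∈ B j) m≡2+i wi∈Bm))
    where
    1+i<n = <-trans 1+i<k k<n
    i<n = <⇒≤ 1+i<n
    m≡2+i : m ≡ 2 + i
    m≡2+i = ≤-antisym (shared-index-near (s≤s z≤n) m≤n (w∈B i<n) wi∈Bm)
                      (≤-trans 1+i<k (≤-pred (shared-index-near 1≤m k<n wk∈Bm (w∈B k<n))))

  w-chordless : ∀ {k i y} → k < n → Adj G (w k) y → suc i < k → y ≢ w i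
  w-chordless {k} {i} k<n wk~wi 1+i<k refl =
    let i<n = <-trans (<⇒≤ 1+i<k) k<n
        (m , 1≤m , m≤n , wk∈Bm , wi∈Bm) = induced (w k) (w i) (suc k , s≤s z≤n , k<n , w∈B k<n)
                                                  (suc i , s≤s z≤n , i<n , w∈B i<n) wk~wi
    in no-clique-spans-gap k<n 1+i<k 1≤m m≤n wk∈Bm wi∈Bm

  w∉B-next : ∀ {k} → suc k < n → w k ∉ B (2 + k)
  w∉B-next 1+k<n wk∈B2+k =
    w-injective ≤-refl 1+k<n (shared-consecutive≡x (s≤s z≤n) 1+k<n (w∈B (<⇒≤ 1+k<n)) wk∈B2+k)

  ∃-forward-neighbour : ∀ {k} → k < n → ∃ λ y → Adj G (w k) y × (1 ≤ k → y ≢ w (k ∸ 1))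
  ∃-forward-neighbour {k} k<n with ∃∈-≢ (proj₂ (clique (suc k) (s≤s z≤n) k<n)) (w k)
  ... | y , y∈B1+k , y≢wk = y , clique-adjacent (s≤s z≤n) k<n (w∈B k<n) y∈B1+k (y≢wk ∘ sym) , y-off k<n y∈B1+k
    where
    y-off : ∀ {k} → k < n → y ∈ B (suc k) → 1 ≤ k → y ≢ w (k ∸ 1)
    y-off {suc k} 1+k<n y∈B2+k _ refl = w∉B-next 1+k<n y∈B2+k

  neighbour-off-path : ∀ {k y} → k < n → Adj G (w k) y → (1 ≤ k → y ≢ w (k ∸ 1)) → ∀ {i} → i ≤ k → y ≢ w i
  neighbour-off-path {k} k<n wk~y y≢w-pred i≤k with m≤n⇒m<n∨m≡n i≤k
  ... | inj₂ refl = λ y≡wk → Graph.irrefl G (subst (Adj G (w k)) y≡wk wk~y)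
  ... | inj₁ i<k with m≤n⇒m<n∨m≡n i<k
  ...   | inj₂ refl  = y≢w-pred (s≤s z≤n)
  ...   | inj₁ 1+i<k = w-chordless k<n wk~y 1+i<k

lemma3p7 : (N : ℕ) (G : Graph N) → IsConnectedGraph G → IsBlockGraph G →
    (n : ℕ) (B : ℕ → Subset N) (x : ℕ → Fin N) → MaximumCliquePath G n B x →
    (r : ℕ) → 1 ≤ r → (H : Hyp N) → IsC′Minor H (𝒞 r G) → AtLeast3Edges H →
    (ℓ : ℕ) → IsLeastLayer G H ℓ → ℓ ≢ 1 → r < n →
    (x₀ : Fin N) → x₀ ∈ B 1 → Layer G 1 x₀ →
    (∀ i → i + 2 ≤ r → withX0 x₀ x i ∉ V H) →
    (withX0 x₀ x (r ∸ 1) ∈ V H)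
    × (∀ y → Adj G (withX0 x₀ x (r ∸ 1)) y → (2 ≤ r → y ≢ withX0 x₀ x (r ∸ 2)) → y ∈ V H)
lemma3p7 N G _ _ n B x (cp , _) (suc k) _ H minor (e₁ , e₂ , _ , E₁ , E₂ , _ , e₁≢e₂ , _) _ _ _ 1+k<n
  x₀ x₀∈B₁ x₀-simplicial prefix∉VH =
    let (y₀ , wk~y₀ , y₀-off) = ∃-forward-neighbour k<n
    in proj₁ (ends∈V wk~y₀ y₀-off) , λ y wk~y y≢w-pred → proj₂ (ends∈V wk~y (y≢w-pred ∘ s≤s))
  where
  open InducedCliquePath G cp x₀∈B₁ x₀-simplicial
  k<n = <⇒≤ 1+k<n

  ends∈V : ∀ {y} → Adj G (w k) y → (1 ≤ k → y ≢ w (k ∸ 1)) → w k ∈ V H × y ∈ V H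
  ends∈V wk~y y≢w-pred =
    pendant-path-ends∈V G H w minor (e₁ , e₂ , E₁ , E₂ , e₁≢e₂)
      (λ i<j j≤k → w-injective i<j (≤-trans (s≤s j≤k) k<n))
      (λ i<k → w-adjacent (≤-trans (s≤s i<k) k<n))
      (λ {i} i<k → prefix∉VH i (subst (_≤ suc k) (+-comm 2 i) (s≤s i<k)))
      wk~y (neighbour-off-path k<n wk~y y≢w-pred)
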